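{- For any graph $G$ with at least two edges, $h(n,G)>\mathrm{ex}(n,G)$ for all $n\ge |V(G)|$.
   Context: For a graph $H$, $F_{H,1}$ is the set of maps $f:E(H)\to E(H)$ with $f(e)\ne e$ for all $e$. A subgraph $G'$ of $H$ is $f$-free if $f(e)\notin E(G')$ for all $e\in E(G')$. $h(n,G)$ is the maximum number of edges of an $n$-vertex graph $H$ for which some $f\in F_{H,1}$ exists with no $f$-free copy of $G$ in $H$. $\mathrm{ex}(n,G)$ is the Turán number. -}

module Defs where

open import Data.Nat using (ℕ; _+_)
open import Data.Fin using (Fin; _<_; _<?_)
open import Data.Bool using (Bool; true; false; _∧_; if_then_else_)
open import Data.List using (List; map; allFin)
open import Data.Nat.ListAction using (sum)
open import Data.Product using (Σ; ∃; ∃-syntax; _×_; _,_; proj₁; proj₂)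
open import Relation.Nullary using (¬_; does)
open import Relation.Binary.PropositionalEquality using (_≡_; _≢_)
open import Function.Definitions using (Injective)

record Graph (n : ℕ) : Set where
  field
    adj    : Fin n → Fin n → Bool
    sym    : ∀ i j → adj i j ≡ adj j i
    irrefl : ∀ i → adj i i ≡ false
open Graph public

-- An edge {i,j} of H is represented by its ordered pair (i , j) with i < j.
IsEdge : ∀ {n} → Graph n → Fin n × Fin n → Set
IsEdge H (i , j) = (i < j) × (adj H i j ≡ true)

Edge : ∀ {n} → Graph n → Set
Edge H = Σ _ (IsEdge H)

numEdges : ∀ {n} → Graph n → ℕ
numEdges {n} H =
  sum (map (λ i → sum (map (λ j → if does (i <? j) ∧ adj H i j then 1 else 0)
                           (allFin n)))
           (allFin n))

-- F_{H,1}: maps f : E(H) → E(H) with f(e) ≠ e for all e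
-- (edges compared by their endpoints).
IsF1 : ∀ {n} (H : Graph n) → (Edge H → Edge H) → Set
IsF1 H f = ∀ e → proj₁ (f e) ≢ proj₁ e

-- A copy of G in H: an injective vertex map sending edges of G to edges of H
-- (a not necessarily induced subgraph of H isomorphic to G).
record Copy {k n : ℕ} (G : Graph k) (H : Graph n) : Set where
  field
    φ      : Fin k → Fin n
    inj    : Injective _≡_ _≡_ φ
    hom    : ∀ u v → adj G u v ≡ true → adj H (φ u) (φ v) ≡ true
open Copy public

InCopy : ∀ {k n} {G : Graph k} {H : Graph n} → Copy G H → Fin n × Fin n → Set
InCopy {G = G} c (a , b) = ∃[ u ] ∃[ v ] (adj G u v ≡ true × φ c u ≡ a × φ c v ≡ b)

FFree : ∀ {k n} {G : Graph k} {H : Graph n} →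
        (f : Edge H → Edge H) → Copy G H → Set
FFree {H = H} f c = ∀ (e : Edge H) → InCopy c (proj₁ e) → ¬ InCopy c (proj₁ (f e))

Contains : ∀ {k n} → Graph k → Graph n → Set
Contains G H = Copy G H

{-# OPTIONS --safe #-}
module Submission where

-- Let T be a G-free graph on n vertices with ex(n,G) edges. Since k ≤ n the complete
-- graph contains G, so T misses some edge ij; H = T + ij has ex(n,G) + 1 edges, hence contains G,
-- and every copy of G in H uses ij. Let f send ij to any other edge of H and every other edge to
-- ij. A copy of G in H contains ij and, as G has two edges, some edge e ≠ ij, and then f(e) = ij
-- lies in the copy: no copy is f-free.
-- Constructively, T exists because the graphs on Fin n can be enumerated and containing G is
-- decidable, so a G-free graph with the most edges can be picked from a finite list.

open import Defs
open import Data.Nat using (ℕ; _≤_; _<_)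
open import Data.Product using (∃-syntax; _×_)
open import Relation.Nullary using (¬_)

open import Data.Bool using (Bool; true; false; _∧_; _∨_; if_then_else_)
open import Data.Bool.Properties
  using (∧-comm; ∨-comm; ∨-zeroʳ; ∨-identityʳ; ¬-not) renaming (_≟_ to _≟ᴮ_)
open import Data.Fin using (Fin; zero; suc; _<?_; inject≤) renaming (_<_ to _<ᶠ_)
open import Data.Fin.Properties
  using (_≟_; <-cmp; <-asym; <⇒≢; suc-injective; inject≤-injective; any?; all?)
open import Data.List
  using (List; []; _∷_; [_]; map; allFin; tabulate; filter; cartesianProductWith)
open import Data.List.Extrema.Nat using (argmax; argmax-all; f[xs]≤f[argmax])
open import Data.List.Membership.Propositional using (_∈_; find)
open import Data.List.Membership.Propositional.Properties using (∈-map⁺; ∈-filter⁺; ∈-allFin)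
open import Data.List.Relation.Unary.All as All using ()
open import Data.List.Relation.Unary.All.Properties using (all-filter)
open import Data.List.Relation.Unary.Any as Any using (Any; here; there; satisfied)
open import Data.List.Relation.Unary.Any.Properties using (cartesianProductWith⁺)
open import Data.List.Relation.Unary.Enumerates.Setoid using (IsEnumeration)
open import Data.Nat using (zero; suc; _+_; z≤n; s≤s)
open import Data.Nat.ListAction using (sum)
open import Data.Nat.Properties
  using (+-0-monoid; ≤-refl; ≤-trans; +-mono-≤; +-mono-<-≤; +-mono-≤-<; ≤-<-trans; <⇒≱; ≤⇒≯)
open import Algebra.Properties.Monoid.Sum +-0-monoid using (sum-cong-≗) renaming (sum to ∑)
open import Data.Product using (Σ; ∃₂; _,_; proj₁; proj₂; swap)
open import Data.Product.Properties using (≡-dec; ×-≡,≡→≡)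
open import Data.Sum using (_⊎_; inj₁; inj₂)
open import Data.Vec.Functional as Vector using (Vector; tail)
import Data.Vec.Functional.Relation.Binary.Equality.Setoid as VecEquality
open import Function using (_∘_; id)
open import Relation.Binary using (Setoid; DecidableEquality; tri<; tri≈; tri>)
open import Relation.Binary.PropositionalEquality as ≡
  using (_≡_; _≢_; refl; trans; cong; cong₂; subst; subst₂)
open import Relation.Nullary using (Dec; yes; no; does; ¬?; contradiction)
open import Relation.Nullary.Decidable
  using (_×-dec_; _→-dec_; map′; dec-true; dec-false; decidable-stable)

private
  variable
    k n : ℕ

sum-map-tabulate : ∀ {A : Set} (g : A → ℕ) (h : Fin n → A) →
                   sum (map g (tabulate h)) ≡ ∑ (g ∘ h)
sum-map-tabulate {zero}  g h = refl
sum-map-tabulate {suc n} g h = cong (g (h zero) +_) (sum-map-tabulate g (h ∘ suc))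

∑-mono : {f g : Fin n → ℕ} → (∀ i → f i ≤ g i) → ∑ f ≤ ∑ g
∑-mono {zero}  f≤g = z≤n
∑-mono {suc n} f≤g = +-mono-≤ (f≤g zero) (∑-mono (f≤g ∘ suc))

∑-mono-< : {f g : Fin n → ℕ} → (∀ i → f i ≤ g i) → ∀ i → f i < g i → ∑ f < ∑ g
∑-mono-< f≤g zero    f<g = +-mono-<-≤ f<g (∑-mono (f≤g ∘ suc))
∑-mono-< f≤g (suc i) f<g = +-mono-≤-< (f≤g zero) (∑-mono-< (f≤g ∘ suc) i f<g)

+-positive : ∀ m {n} → 0 < m + n → 0 < m ⊎ 0 < n
+-positive zero    0<n = inj₂ 0<n
+-positive (suc m) _   = inj₁ (s≤s z≤n)

+-≥2 : ∀ m {n} → 2 ≤ m + n → 2 ≤ m ⊎ (0 < m × 0 < n) ⊎ 2 ≤ n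
+-≥2 zero          2≤n       = inj₂ (inj₂ 2≤n)
+-≥2 (suc zero)    (s≤s 1≤n) = inj₂ (inj₁ (s≤s z≤n , 1≤n))
+-≥2 (suc (suc m)) _         = inj₁ (s≤s (s≤s z≤n))

∑-positive : (f : Fin n → ℕ) → 0 < ∑ f → ∃[ i ] 0 < f i
∑-positive {suc n} f 0<∑ with +-positive (f zero) 0<∑
... | inj₁ 0<f₀  = zero , 0<f₀
... | inj₂ 0<∑′ = let i , 0<fi = ∑-positive (f ∘ suc) 0<∑′ in suc i , 0<fi

∑-≥2 : (f : Fin n → ℕ) → 2 ≤ ∑ f →
       (∃[ i ] 2 ≤ f i) ⊎ (∃₂ λ i j → i ≢ j × 0 < f i × 0 < f j)
∑-≥2 {suc n} f 2≤∑ with +-≥2 (f zero) 2≤∑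
... | inj₁ 2≤f₀ = inj₁ (zero , 2≤f₀)
... | inj₂ (inj₁ (0<f₀ , 0<∑′)) =
  let j , 0<fj = ∑-positive (f ∘ suc) 0<∑′ in inj₂ (zero , suc j , (λ ()) , 0<f₀ , 0<fj)
... | inj₂ (inj₂ 2≤∑′) with ∑-≥2 (f ∘ suc) 2≤∑′
...   | inj₁ (i , 2≤fi) = inj₁ (suc i , 2≤fi)
...   | inj₂ (i , j , i≢j , 0<fi , 0<fj) =
  inj₂ (suc i , suc j , i≢j ∘ suc-injective , 0<fi , 0<fj)

vectors : ∀ {a} {A : Set a} → List A → (n : ℕ) → List (Vector A n)
vectors xs zero    = [ (λ ()) ]
vectors xs (suc n) = cartesianProductWith Vector._∷_ xs (vectors xs n)

module _ {a ℓ} (S : Setoid a ℓ) where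
  open Setoid S using (_≈_)
  open VecEquality S using (_≋_; ≋-setoid)

  vectors-enumerates : ∀ {xs} → IsEnumeration S xs →
                       ∀ n → IsEnumeration (≋-setoid n) (vectors xs n)
  vectors-enumerates xs∋ zero    v = here (λ ())
  vectors-enumerates xs∋ (suc n) v =
    cartesianProductWith⁺ Vector._∷_ ∷-cong (xs∋ (v zero)) (vectors-enumerates xs∋ n (tail v))
    where
    ∷-cong : ∀ {x ys} → v zero ≈ x → tail v ≋ ys → v ≋ (x Vector.∷ ys)
    ∷-cong v₀≈x _     zero    = v₀≈x
    ∷-cong _    tv≋ys (suc i) = tv≋ys i

-- Subgraphs and edge counts

infix 4 _⊆ᴳ_
_⊆ᴳ_ : Graph n → Graph n → Set
T ⊆ᴳ H = ∀ a b → adj T a b ≡ true → adj H a b ≡ true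

copy-mono : {G : Graph k} {T H : Graph n} → T ⊆ᴳ H → Copy G T → Copy G H
copy-mono T⊆H c = record { φ = φ c ; inj = inj c ; hom = λ u v Guv → T⊆H _ _ (hom c u v Guv) }

adj⇒≢ : (G : Graph k) {u v : Fin k} → adj G u v ≡ true → u ≢ v
adj⇒≢ G {u} Guu refl = contradiction (trans (≡.sym Guu) (irrefl G u)) λ ()

edgeless : ∀ n → Graph n
edgeless n = record { adj = λ _ _ → false ; sym = λ _ _ → refl ; irrefl = λ _ → refl }

edgeless-free : {G : Graph k} → Edge G → ¬ Contains G (edgeless n)
edgeless-free ((u , v) , _ , Guv) c = contradiction (hom c u v Guv) λ ()

complete-contains : {G : Graph k} {H : Graph n} → k ≤ n →
                    (∀ a b → a <ᶠ b → adj H a b ≡ true) → Contains G H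
complete-contains {G = G} {H = H} k≤n complete = record
  { φ   = embed
  ; inj = embed-injective
  ; hom = λ u v Guv → adjacent (adj⇒≢ G Guv ∘ embed-injective)
  }
  where
  embed : Fin _ → Fin _
  embed u = inject≤ u k≤n
  embed-injective : ∀ {u v} → embed u ≡ embed v → u ≡ v
  embed-injective {u} {v} = inject≤-injective k≤n k≤n u v
  adjacent : ∀ {a b} → a ≢ b → adj H a b ≡ true
  adjacent {a} {b} a≢b with <-cmp a b
  ... | tri< a<b _ _ = complete a b a<b
  ... | tri≈ _ a≡b _ = contradiction a≡b a≢b
  ... | tri> _ _ b<a = trans (Graph.sym H a b) (complete b a b<a)

edgeIndicator : Graph n → Fin n → Fin n → ℕ
edgeIndicator H a b = if does (a <? b) ∧ adj H a b then 1 else 0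

numEdges-∑ : (H : Graph n) → numEdges H ≡ ∑ λ a → ∑ (edgeIndicator H a)
numEdges-∑ {n} H = trans (sum-map-tabulate (λ a → sum (map (edgeIndicator H a) (allFin n))) id)
                         (sum-cong-≗ λ a → sum-map-tabulate (edgeIndicator H a) id)

edgeIndicator≤1 : (H : Graph n) → ∀ a b → edgeIndicator H a b ≤ 1
edgeIndicator≤1 H a b with does (a <? b) ∧ adj H a b
... | true  = ≤-refl
... | false = z≤n

edgeIndicator-positive : (H : Graph n) → ∀ a b → 0 < edgeIndicator H a b → IsEdge H (a , b)
edgeIndicator-positive H a b = positive (a <? b) (adj H a b)
  where
  positive : ∀ {P : Set} (P? : Dec P) x → 0 < (if does P? ∧ x then 1 else 0) → P × x ≡ true
  positive (yes p) true _ = p , refl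

edgeIndicator-mono : {T H : Graph n} → T ⊆ᴳ H → ∀ a b → edgeIndicator T a b ≤ edgeIndicator H a b
edgeIndicator-mono {T = T} T⊆H a b with does (a <? b) | adj T a b in Tab
... | false | _     = z≤n
... | true  | false = z≤n
... | true  | true  rewrite T⊆H a b Tab = ≤-refl

numEdges-mono : {T H : Graph n} → T ⊆ᴳ H → numEdges T ≤ numEdges H
numEdges-mono {T = T} {H} T⊆H rewrite numEdges-∑ T | numEdges-∑ H =
  ∑-mono λ a → ∑-mono (edgeIndicator-mono {T = T} {H} T⊆H a)

numEdges-mono-< : {T H : Graph n} → T ⊆ᴳ H →
                  ∀ {a b} → a <ᶠ b → adj T a b ≡ false → adj H a b ≡ true →
                  numEdges T < numEdges H
numEdges-mono-< {T = T} {H} T⊆H {a} {b} a<b Tab Hab rewrite numEdges-∑ T | numEdges-∑ H =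
  ∑-mono-< (λ x → ∑-mono (mono x)) a (∑-mono-< (mono a) b new-edge)
  where
  mono : ∀ x y → edgeIndicator T x y ≤ edgeIndicator H x y
  mono = edgeIndicator-mono {T = T} {H} T⊆H
  new-edge : edgeIndicator T a b < edgeIndicator H a b
  new-edge rewrite dec-true (a <? b) a<b | Tab | Hab = s≤s z≤n

two-edges : (G : Graph k) → 2 ≤ numEdges G →
            Σ (Edge G) λ e → Σ (Edge G) λ e′ → proj₁ e ≢ proj₁ e′
two-edges G 2≤|G| with ∑-≥2 _ (subst (2 ≤_) (numEdges-∑ G) 2≤|G|)
... | inj₁ (u , 2≤row) with ∑-≥2 (edgeIndicator G u) 2≤row
...   | inj₁ (v , 2≤uv) = contradiction 2≤uv (≤⇒≯ (edgeIndicator≤1 G u v))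
...   | inj₂ (v , v′ , v≢v′ , uv , uv′) =
  (_ , edgeIndicator-positive G u v uv) , (_ , edgeIndicator-positive G u v′ uv′) ,
  v≢v′ ∘ cong proj₂
two-edges G 2≤|G| | inj₂ (u , u′ , u≢u′ , row , row′) =
  let v  , uv   = ∑-positive (edgeIndicator G u) row
      v′ , u′v′ = ∑-positive (edgeIndicator G u′) row′
  in (_ , edgeIndicator-positive G u v uv) , (_ , edgeIndicator-positive G u′ v′ u′v′) ,
     u≢u′ ∘ cong proj₁

-- Extremal graphs

bools : List Bool
bools = true ∷ false ∷ []

bools-enumerates : IsEnumeration (≡.setoid Bool) bools
bools-enumerates true  = here refl
bools-enumerates false = there (here refl)

relations : ∀ n → List (Fin n → Fin n → Bool)
relations n = vectors (vectors bools n) n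

relations-enumerate : (R : Fin n → Fin n → Bool) →
                      Any (λ R′ → ∀ a b → R a b ≡ R′ a b) (relations n)
relations-enumerate {n} =
  vectors-enumerates (VecEquality.≋-setoid (≡.setoid Bool) n)
                     (vectors-enumerates (≡.setoid Bool) bools-enumerates n) n

fromRelation : (Fin n → Fin n → Bool) → Graph n
fromRelation {n} R = record { adj = adjacent ; sym = symmetric ; irrefl = irreflexive }
  where
  adjacent : Fin n → Fin n → Bool
  adjacent a b = if does (a ≟ b) then false else R a b ∧ R b a
  symmetric : ∀ a b → adjacent a b ≡ adjacent b a
  symmetric a b with a ≟ b | b ≟ a
  ... | yes _    | yes _    = refl
  ... | no _     | no _     = ∧-comm (R a b) (R b a)
  ... | yes refl | no b≢a   = contradiction refl b≢a
  ... | no a≢b   | yes refl = contradiction refl a≢b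
  irreflexive : ∀ a → adjacent a a ≡ false
  irreflexive a rewrite dec-true (a ≟ a) refl = refl

allGraphs : ∀ n → List (Graph n)
allGraphs n = map fromRelation (relations n)

allGraphs-complete : (H : Graph n) → ∃[ H′ ] H′ ∈ allGraphs n × H ⊆ᴳ H′ × H′ ⊆ᴳ H
allGraphs-complete H with R , R∈ , H≗R ← find (relations-enumerate (adj H)) =
  fromRelation R , ∈-map⁺ fromRelation R∈ , H⊆R , R⊆H
  where
  H⊆R : H ⊆ᴳ fromRelation R
  H⊆R a b Hab rewrite dec-false (a ≟ b) (adj⇒≢ H Hab)
                    | ≡.sym (H≗R a b) | ≡.sym (H≗R b a) | Graph.sym H b a | Hab = refl
  R⊆H : fromRelation R ⊆ᴳ H
  R⊆H a b Rab with a ≟ b | R a b in Rab′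
  ... | no _ | true = trans (H≗R a b) Rab′

IsCopy : Graph k → Graph n → (Fin k → Fin n) → Set
IsCopy G H ψ = (∀ u v → ψ u ≡ ψ v → u ≡ v) ×
               (∀ u v → adj G u v ≡ true → adj H (ψ u) (ψ v) ≡ true)

isCopy? : (G : Graph k) (H : Graph n) → ∀ ψ → Dec (IsCopy G H ψ)
isCopy? G H ψ =
  all? (λ u → all? λ v → ψ u ≟ ψ v →-dec u ≟ v) ×-dec
  all? (λ u → all? λ v → adj G u v ≟ᴮ true →-dec adj H (ψ u) (ψ v) ≟ᴮ true)

contains? : (G : Graph k) (H : Graph n) → Dec (Contains G H)
contains? {k} {n} G H = map′ toCopy fromCopy (Any.any? (isCopy? G H) (vectors (allFin n) k))
  where
  toCopy : Any (IsCopy G H) (vectors (allFin n) k) → Copy G H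
  toCopy ψ∈ with ψ , injective , homomorphic ← satisfied ψ∈ =
    record { φ = ψ ; inj = injective _ _ ; hom = homomorphic }
  fromCopy : Copy G H → Any (IsCopy G H) (vectors (allFin n) k)
  fromCopy c = Any.map transport (vectors-enumerates (≡.setoid (Fin n)) ∈-allFin k (φ c))
    where
    transport : ∀ {ψ} → (∀ u → φ c u ≡ ψ u) → IsCopy G H ψ
    transport φ≗ψ =
      (λ u v ψu≡ψv → inj c (trans (φ≗ψ u) (trans ψu≡ψv (≡.sym (φ≗ψ v))))) ,
      (λ u v Guv → subst₂ (λ a b → adj H a b ≡ true) (φ≗ψ u) (φ≗ψ v) (hom c u v Guv))

extremal : (G : Graph k) {T₀ : Graph n} → ¬ Contains G T₀ →
           ∃[ T ] ¬ Contains G T × (∀ H → ¬ Contains G H → numEdges H ≤ numEdges T)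
extremal {n = n} G {T₀} T₀-free = T , T-free , T-maximum
  where
  free? : ∀ H → Dec (¬ Contains G H)
  free? H = ¬? (contains? G H)
  candidates : List (Graph n)
  candidates = filter free? (allGraphs n)
  T : Graph n
  T = argmax numEdges T₀ candidates
  T-free : ¬ Contains G T
  T-free = argmax-all numEdges T₀-free (all-filter free? (allGraphs n))
  T-maximum : ∀ H → ¬ Contains G H → numEdges H ≤ numEdges T
  T-maximum H H-free with H′ , H′∈ , H⊆H′ , H′⊆H ← allGraphs-complete H =
    ≤-trans (numEdges-mono {T = H} {H′} H⊆H′)
            (All.lookup (f[xs]≤f[argmax] T₀ candidates)
                        (∈-filter⁺ free? H′∈ (H-free ∘ copy-mono H′⊆H)))

missing-edge : {G : Graph k} {T : Graph n} → k ≤ n → ¬ Contains G T →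
               ∃₂ λ a b → a <ᶠ b × adj T a b ≡ false
missing-edge {T = T} k≤n T-free =
  decidable-stable (any? λ a → any? λ b → a <? b ×-dec adj T a b ≟ᴮ false) λ none →
    T-free (complete-contains k≤n λ a b a<b → ¬-not λ Tab → none (a , b , a<b , Tab))

-- Adding an edge

_≟²_ : DecidableEquality (Fin n × Fin n)
_≟²_ = ≡-dec _≟_ _≟_

module _ (T : Graph n) {i j : Fin n} (i≢j : i ≢ j) where

  private
    is-ij : Fin n → Fin n → Bool
    is-ij a b = does ((a , b) ≟² (i , j))

    joins : Fin n → Fin n → Bool
    joins a b = is-ij a b ∨ is-ij b a

    joins-irrefl : ∀ a → joins a a ≡ false
    joins-irrefl a = cong₂ _∨_ loop loop
      where
      loop : is-ij a a ≡ false
      loop = dec-false ((a , a) ≟² (i , j)) λ aa≡ij →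
        i≢j (trans (≡.sym (cong proj₁ aa≡ij)) (cong proj₂ aa≡ij))

  addEdge : Graph n
  addEdge = record
    { adj    = λ a b → adj T a b ∨ joins a b
    ; sym    = λ a b → cong₂ _∨_ (Graph.sym T a b) (∨-comm (is-ij a b) (is-ij b a))
    ; irrefl = λ a → cong₂ _∨_ (irrefl T a) (joins-irrefl a)
    }

  ⊆-addEdge : T ⊆ᴳ addEdge
  ⊆-addEdge a b Tab rewrite Tab = refl

  addEdge-joins : adj addEdge i j ≡ true
  addEdge-joins rewrite dec-true ((i , j) ≟² (i , j)) refl = ∨-zeroʳ (adj T i j)

  addEdge-elsewhere : ∀ {a b} → adj addEdge a b ≡ true →
                      (a , b) ≢ (i , j) → (b , a) ≢ (i , j) → adj T a b ≡ true
  addEdge-elsewhere {a} {b} ab∈H ab≢ij ba≢ij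
    rewrite dec-false ((a , b) ≟² (i , j)) ab≢ij | dec-false ((b , a) ≟² (i , j)) ba≢ij =
    trans (≡.sym (∨-identityʳ (adj T a b))) ab∈H

addEdge-in-every-copy : {G : Graph k} {T : Graph n} {i j : Fin n} (i≢j : i ≢ j) →
                        ¬ Contains G T → (c : Copy G (addEdge T i≢j)) → InCopy c (i , j)
addEdge-in-every-copy {G = G} {T} {i} {j} i≢j T-free c =
  decidable-stable inCopy? λ avoids → T-free record
    { φ   = φ c
    ; inj = inj c
    ; hom = λ u v Guv → addEdge-elsewhere T i≢j (hom c u v Guv)
        (λ uv≡ij → avoids (u , v , Guv , cong proj₁ uv≡ij , cong proj₂ uv≡ij))
        (λ vu≡ij → avoids (v , u , trans (Graph.sym G v u) Guv , cong proj₁ vu≡ij , cong proj₂ vu≡ij))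
    }
  where
  inCopy? : Dec (InCopy c (i , j))
  inCopy? = any? λ u → any? λ v → adj G u v ≟ᴮ true ×-dec φ c u ≟ i ×-dec φ c v ≟ j

-- Edges of a copy

orient : (H : Graph n) {a b : Fin n} → a ≢ b → adj H a b ≡ true →
         Σ (Edge H) λ e → proj₁ e ≡ (a , b) ⊎ proj₁ e ≡ (b , a)
orient H {a} {b} a≢b Hab with <-cmp a b
... | tri< a<b _ _ = ((a , b) , a<b , Hab) , inj₁ refl
... | tri≈ _ a≡b _ = contradiction a≡b a≢b
... | tri> _ _ b<a = ((b , a) , b<a , trans (Graph.sym H b a) Hab) , inj₂ refl

module _ {G : Graph k} {H : Graph n} (c : Copy G H) where

  private
    φ²-injective : ∀ {u v u′ v′} → (φ c u , φ c v) ≡ (φ c u′ , φ c v′) → (u , v) ≡ (u′ , v′)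
    φ²-injective same = ×-≡,≡→≡ (inj c (cong proj₁ same) , inj c (cong proj₂ same))

    crossing : ∀ {u v u′ v′ : Fin k} → u <ᶠ v → u′ <ᶠ v′ → (u , v) ≢ (v′ , u′)
    crossing u<v u′<v′ refl = <-asym u<v u′<v′

  image : ∀ {u v} → IsEdge G (u , v) →
          Σ (Edge H) λ e → proj₁ e ≡ (φ c u , φ c v) ⊎ proj₁ e ≡ (φ c v , φ c u)
  image {u} {v} (_ , Guv) = orient H (adj⇒≢ G Guv ∘ inj c) (hom c u v Guv)

  image-endpoints : ∀ {u v} → IsEdge G (u , v) → Fin n × Fin n
  image-endpoints uv = proj₁ (proj₁ (image uv))

  image-inCopy : ∀ {u v} (uv : IsEdge G (u , v)) → InCopy c (image-endpoints uv)
  image-inCopy {u} {v} uv@(_ , Guv) with proj₂ (image uv)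
  ... | inj₁ ≡uv = subst (InCopy c) (≡.sym ≡uv) (u , v , Guv , refl , refl)
  ... | inj₂ ≡vu = subst (InCopy c) (≡.sym ≡vu) (v , u , trans (Graph.sym G v u) Guv , refl , refl)

  image-injective : ∀ {u v u′ v′} (uv : IsEdge G (u , v)) (uv′ : IsEdge G (u′ , v′)) →
                    image-endpoints uv ≡ image-endpoints uv′ → (u , v) ≡ (u′ , v′)
  image-injective uv@(u<v , _) uv′@(u′<v′ , _) same with proj₂ (image uv) | proj₂ (image uv′)
  ... | inj₁ ≡uv | inj₁ ≡u′v′ = φ²-injective (trans (≡.sym ≡uv) (trans same ≡u′v′))
  ... | inj₂ ≡vu | inj₂ ≡v′u′ = cong swap (φ²-injective (trans (≡.sym ≡vu) (trans same ≡v′u′)))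
  ... | inj₁ ≡uv | inj₂ ≡v′u′ =
    contradiction (φ²-injective (trans (≡.sym ≡uv) (trans same ≡v′u′))) (crossing u<v u′<v′)
  ... | inj₂ ≡vu | inj₁ ≡u′v′ =
    contradiction (φ²-injective (trans (≡.sym ≡u′v′) (trans (≡.sym same) ≡vu))) (crossing u′<v′ u<v)

  copy-edge-besides : 2 ≤ numEdges G → (p : Fin n × Fin n) →
                      Σ (Edge H) λ e → InCopy c (proj₁ e) × proj₁ e ≢ p
  copy-edge-besides 2≤|G| p with two-edges G 2≤|G|
  ... | (_ , uv) , (_ , uv′) , uv≢uv′ with image-endpoints uv ≟² p | image-endpoints uv′ ≟² p
  ...   | no ≢p  | _       = proj₁ (image uv) , image-inCopy uv , ≢p
  ...   | yes _  | no ≢p   = proj₁ (image uv′) , image-inCopy uv′ , ≢p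
  ...   | yes ≡p | yes ≡p′ = contradiction (image-injective uv uv′ (trans ≡p (≡.sym ≡p′))) uv≢uv′

module _ {H : Graph n} (e₀ e₁ : Edge H) where

  redirect : Edge H → Edge H
  redirect e with proj₁ e ≟² proj₁ e₀
  ... | yes _ = e₁
  ... | no _  = e₀

  redirect-F1 : proj₁ e₁ ≢ proj₁ e₀ → IsF1 H redirect
  redirect-F1 e₁≢e₀ e with proj₁ e ≟² proj₁ e₀
  ... | yes e≡e₀ = λ e₁≡e → e₁≢e₀ (trans e₁≡e e≡e₀)
  ... | no e≢e₀  = e≢e₀ ∘ ≡.sym

  redirect-elsewhere : ∀ e → proj₁ e ≢ proj₁ e₀ → redirect e ≡ e₀
  redirect-elsewhere e e≢e₀ with proj₁ e ≟² proj₁ e₀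
  ... | yes e≡e₀ = contradiction e≡e₀ e≢e₀
  ... | no _     = refl

  redirect-not-free : {G : Graph k} (c : Copy G H) → InCopy c (proj₁ e₀) →
                      ∀ e → InCopy c (proj₁ e) → proj₁ e ≢ proj₁ e₀ → ¬ FFree redirect c
  redirect-not-free c e₀∈c e e∈c e≢e₀ free =
    free e e∈c (subst (InCopy c ∘ proj₁) (≡.sym (redirect-elsewhere e e≢e₀)) e₀∈c)

proposition2p3 : (k : ℕ) (G : Graph k) → 2 ≤ numEdges G →
    (n : ℕ) → k ≤ n →
    ∃[ H ] ∃[ f ] (IsF1 {n} H f × (∀ (c : Copy G H) → ¬ FFree f c) ×
      (∀ (H' : Graph n) → ¬ Contains G H' → numEdges H' < numEdges H))
proposition2p3 k G 2≤|G| n k≤n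
  with T , T-free , T-maximum ← extremal G (edgeless-free {n = n} (proj₁ (two-edges G 2≤|G|)))
  with i , j , i<j , ij∉T ← missing-edge k≤n T-free
  = H , redirect e₀ e₁ , redirect-F1 e₀ e₁ e₁≢e₀ , no-free-copy ,
    λ H′ H′-free → ≤-<-trans (T-maximum H′ H′-free) T<H
  where
  i≢j : i ≢ j
  i≢j = <⇒≢ i<j
  H : Graph n
  H = addEdge T i≢j
  T<H : numEdges T < numEdges H
  T<H = numEdges-mono-< {T = T} {H} (⊆-addEdge T i≢j) i<j ij∉T (addEdge-joins T i≢j)
  c₀ : Copy G H
  c₀ = decidable-stable (contains? G H) λ H-free → <⇒≱ T<H (T-maximum H H-free)
  e₀ e₁ : Edge H
  e₀ = (i , j) , i<j , addEdge-joins T i≢j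
  e₁ = proj₁ (copy-edge-besides c₀ 2≤|G| (i , j))
  e₁≢e₀ : proj₁ e₁ ≢ proj₁ e₀
  e₁≢e₀ = proj₂ (proj₂ (copy-edge-besides c₀ 2≤|G| (i , j)))
  no-free-copy : ∀ c → ¬ FFree (redirect e₀ e₁) c
  no-free-copy c with e , e∈c , e≢e₀ ← copy-edge-besides c 2≤|G| (i , j) =
    redirect-not-free e₀ e₁ c (addEdge-in-every-copy i≢j T-free c) e e∈c e≢e₀
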